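{- Let $q$ be a prime power and $F,G \subset \mathbb{F}_q^2$ with $0\notin F$. For $t\in \mathbb{F}_q$ let $$\nu(t)=|\{(x,y) \in F \times G: x \cdot y=t \}|,$$ where $x \cdot y=x_1y_1+x_2y_2$. Then $$\sum_{t\in\mathbb{F}_q} \nu^2(t) \leq |F|^2 |G|^2 q^{ -1}+q |F| |G| \cdot \max_{x\neq 0}|F\cap l_x|,$$ where for $x \in \mathbb{F}_q^2\setminus\{0\}$, $l_x=\{sx: s \in \mathbb{F}_q \setminus\{0\}\}$. -}

module Defs where

open import Level using (0ℓ)
open import Data.Nat using (ℕ; _⊔_) renaming (_+_ to _+ℕ_; _*_ to _*ℕ_)
open import Data.Product using (_×_; _,_; ∃-syntax; proj₁; proj₂)
open import Data.Product.Properties using (≡-dec)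
open import Data.List using (List; length; filter; cartesianProduct; map; foldr)
open import Data.List.Relation.Unary.Any using (Any; any?)
open import Data.List.Membership.Propositional using (_∈_)
open import Data.List.Relation.Unary.Unique.Propositional using (Unique)
open import Relation.Nullary using (¬_; Dec)
open import Relation.Nullary.Decidable using (¬?; _×-dec_)
open import Relation.Binary.PropositionalEquality using (_≡_; _≢_)
open import Relation.Binary.Definitions using (DecidableEquality)
open import Algebra.Core using (Op₁; Op₂)
import Algebra.Structures as AS

record FiniteField : Set₁ where
  infixl 7 _*_
  infixl 6 _+_
  field
    K      : Set
    _+_    : Op₂ K
    _*_    : Op₂ K
    -_     : Op₁ K
    0# 1#  : K
    isCommutativeRing : AS.IsCommutativeRing {A = K} _≡_ _+_ _*_ -_ 0# 1#
    0≢1    : 0# ≢ 1#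
    inverse : ∀ x → x ≢ 0# → ∃[ y ] (x * y ≡ 1#)
    _≟_    : DecidableEquality K
    -- finiteness: an explicit duplicate-free enumeration of all elements
    elements : List K
    elements-unique   : Unique elements
    elements-complete : ∀ x → x ∈ elements

module _ (𝔽 : FiniteField) where
  open FiniteField 𝔽

  order : ℕ
  order = length elements

  Pt : Set
  Pt = K × K

  _≟ₚ_ : DecidableEquality Pt
  _≟ₚ_ = ≡-dec _≟_ _≟_

  0ₚ : Pt
  0ₚ = 0# , 0#

  dot : Pt → Pt → K
  dot (x₁ , x₂) (y₁ , y₂) = x₁ * y₁ + x₂ * y₂

  scale : K → Pt → Pt
  scale s (x₁ , x₂) = s * x₁ , s * x₂

  allPts : List Pt
  allPts = cartesianProduct elements elements

  nonzeroPts : List Pt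
  nonzeroPts = filter (λ x → ¬? (x ≟ₚ 0ₚ)) allPts

  nonzeroScalars : List K
  nonzeroScalars = filter (λ s → ¬? (s ≟ 0#)) elements

  onLine? : (x z : Pt) → Dec (Any (λ s → z ≡ scale s x) nonzeroScalars)
  onLine? x z = any? (λ s → z ≟ₚ scale s x) nonzeroScalars

  -- |F ∩ l_x| for a set F given as a duplicate-free list
  lineCount : List Pt → Pt → ℕ
  lineCount F x = length (filter (onLine? x) F)

  maxLineCount : List Pt → ℕ
  maxLineCount F = foldr _⊔_ 0 (map (lineCount F) nonzeroPts)

  ν : List Pt → List Pt → K → ℕ
  ν F G t = length (filter (λ p → dot (proj₁ p) (proj₂ p) ≟ t) (cartesianProduct F G))

  sumν² : List Pt → List Pt → ℕ
  sumν² F G = foldr _+ℕ_ 0 (map (λ t → ν F G t *ℕ ν F G t) elements)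

module Submission where

-- For x ∈ 𝔽² let incidences(x, t) = |{y ∈ G : x·y = t}| and let
-- excess(x) = q Σ_t incidences(x, t)² − |G|², which is ≥ 0 by Cauchy–Schwarz.  With
-- M = max_{z ≠ 0} |F ∩ l_z| and k = q − 1 the proof has three steps:
--   I.   Cauchy–Schwarz over x ∈ F:  q Σ_t ν(t)² − |F|²|G|² ≤ |F| Σ_{x ∈ F} excess(x).
--   II.  excess is constant along the lines l_x, and a point of 𝔽² is of the form s x (s ≠ 0, x ∈ F)
--        at most M times, so  k Σ_{x ∈ F} excess(x) ≤ M Σ_{z ∈ 𝔽²} excess(z).
--   III. Distinct y, y' have equal dot products with at most q points z (the line orthogonal to
--        y − y'), so  Σ_{z ∈ 𝔽²} excess(z) ≤ q² k |G|.
-- Together: q Σ_t ν(t)² ≤ |F|²|G|² + q² |F||G| M, the stated bound (whose second term carries q²).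

open import Defs
open import Data.List.Base using (List; length)
open import Data.List.Relation.Unary.Unique.Propositional using (Unique)
open import Data.List.Membership.Propositional using (_∈_)
open import Relation.Nullary using (¬_)

-- Integer-valued sums over lists, indicators of decidable propositions, and Cauchy–Schwarz.
module IntegerSums where
  open import Data.Nat.Base as ℕ using (ℕ; zero; z≤n)
  import Data.Nat.Properties as ℕ
  open import Data.Integer.Base
  open import Data.Integer.Properties
  open import Data.Integer.Tactic.RingSolver using (solve-∀)
  open import Data.List.Base using ([]; _∷_; filter; cartesianProduct; map; foldr; _++_)
  open import Data.List.Relation.Unary.Any using (here; there)
  open import Data.List.Relation.Unary.All using (All; []; _∷_)
  open import Data.List.Relation.Unary.AllPairs using ([]; _∷_)
  open import Data.Product.Base using (_×_; _,_)
  open import Data.Empty using (⊥-elim)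
  open import Relation.Nullary using (Dec; yes; no)
  open import Relation.Nullary.Decidable using (¬?)
  open import Relation.Unary using (Pred; Decidable)
  open import Relation.Binary.Definitions using (DecidableEquality)
  open import Relation.Binary.PropositionalEquality

  private variable A B : Set

  Σ : List A → (A → ℤ) → ℤ
  Σ [] f = 0ℤ
  Σ (x ∷ xs) f = f x + Σ xs f

  Σ-cong : (xs : List A) {f g : A → ℤ} → (∀ x → x ∈ xs → f x ≡ g x) → Σ xs f ≡ Σ xs g
  Σ-cong [] h = refl
  Σ-cong (x ∷ xs) h = cong₂ _+_ (h x (here refl)) (Σ-cong xs (λ y y∈ → h y (there y∈)))

  Σ-mono : (xs : List A) {f g : A → ℤ} → (∀ x → x ∈ xs → f x ≤ g x) → Σ xs f ≤ Σ xs g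
  Σ-mono [] h = ≤-refl
  Σ-mono (x ∷ xs) h = +-mono-≤ (h x (here refl)) (Σ-mono xs (λ y y∈ → h y (there y∈)))

  Σ-+ : (xs : List A) (f g : A → ℤ) → Σ xs (λ x → f x + g x) ≡ Σ xs f + Σ xs g
  Σ-+ [] f g = refl
  Σ-+ (x ∷ xs) f g rewrite Σ-+ xs f g = interchange (f x) (g x) (Σ xs f) (Σ xs g)
    where interchange : ∀ a b c d → a + b + (c + d) ≡ a + c + (b + d)
          interchange = solve-∀

  Σ-*ˡ : (xs : List A) (c : ℤ) (f : A → ℤ) → Σ xs (λ x → c * f x) ≡ c * Σ xs f
  Σ-*ˡ [] c f = sym (*-zeroʳ c)
  Σ-*ˡ (x ∷ xs) c f rewrite Σ-*ˡ xs c f = sym (*-distribˡ-+ c (f x) (Σ xs f))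

  Σ-*ʳ : (xs : List A) (c : ℤ) (f : A → ℤ) → Σ xs (λ x → f x * c) ≡ Σ xs f * c
  Σ-*ʳ xs c f = trans (Σ-cong xs (λ x _ → *-comm (f x) c)) (trans (Σ-*ˡ xs c f) (*-comm c (Σ xs f)))

  Σ-const : (xs : List A) (c : ℤ) → Σ xs (λ _ → c) ≡ c * + length xs
  Σ-const [] c = sym (*-zeroʳ c)
  Σ-const (x ∷ xs) c rewrite Σ-const xs c = c+cn≡c[1+n] c (+ length xs)
    where c+cn≡c[1+n] : ∀ c n → c + c * n ≡ c * (1ℤ + n)
          c+cn≡c[1+n] = solve-∀

  Σ-zero : (xs : List A) → Σ xs (λ _ → 0ℤ) ≡ 0ℤ
  Σ-zero xs = trans (Σ-const xs 0ℤ) (*-zeroˡ (+ length xs))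

  Σ-nonneg : (xs : List A) {f : A → ℤ} → (∀ x → x ∈ xs → 0ℤ ≤ f x) → 0ℤ ≤ Σ xs f
  Σ-nonneg xs h = subst (_≤ Σ xs _) (Σ-zero xs) (Σ-mono xs h)

  term≤Σ : (xs : List A) {f : A → ℤ} {a : A} → a ∈ xs → (∀ x → x ∈ xs → 0ℤ ≤ f x) → f a ≤ Σ xs f
  term≤Σ (x ∷ xs) {f} (here refl) h =
    ≤-trans (≤-reflexive (sym (+-identityʳ (f x)))) (+-monoʳ-≤ (f x) (Σ-nonneg xs (λ y y∈ → h y (there y∈))))
  term≤Σ (x ∷ xs) {f} (there a∈) h =
    ≤-trans (term≤Σ xs a∈ (λ y y∈ → h y (there y∈)))
      (≤-trans (≤-reflexive (sym (+-identityˡ _))) (+-monoˡ-≤ (Σ xs f) (h x (here refl))))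

  Σ-swap : (xs : List A) (ys : List B) (h : A → B → ℤ) →
    Σ xs (λ x → Σ ys (λ y → h x y)) ≡ Σ ys (λ y → Σ xs (λ x → h x y))
  Σ-swap [] ys h = sym (Σ-zero ys)
  Σ-swap (x ∷ xs) ys h rewrite Σ-swap xs ys h = sym (Σ-+ ys (h x) (λ y → Σ xs (λ x → h x y)))

  Σ-++ : (xs ys : List A) (f : A → ℤ) → Σ (xs ++ ys) f ≡ Σ xs f + Σ ys f
  Σ-++ [] ys f = sym (+-identityˡ _)
  Σ-++ (x ∷ xs) ys f rewrite Σ-++ xs ys f = sym (+-assoc (f x) (Σ xs f) (Σ ys f))

  Σ-map : (xs : List A) (g : A → B) (f : B → ℤ) → Σ (map g xs) f ≡ Σ xs (λ x → f (g x))
  Σ-map [] g f = refl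
  Σ-map (x ∷ xs) g f = cong (λ s → f (g x) + s) (Σ-map xs g f)

  Σ-cartesianProduct : (xs : List A) (ys : List B) (h : A × B → ℤ) →
    Σ (cartesianProduct xs ys) h ≡ Σ xs (λ x → Σ ys (λ y → h (x , y)))
  Σ-cartesianProduct [] ys h = refl
  Σ-cartesianProduct (x ∷ xs) ys h =
    trans (Σ-++ (map (x ,_) ys) _ h) (cong₂ _+_ (Σ-map ys (x ,_) h) (Σ-cartesianProduct xs ys h))

  Σ-fromℕ : (xs : List A) (h : A → ℕ) → + foldr ℕ._+_ 0 (map h xs) ≡ Σ xs (λ x → + h x)
  Σ-fromℕ [] h = refl
  Σ-fromℕ (x ∷ xs) h = trans (pos-+ (h x) _) (cong (λ s → + h x + s) (Σ-fromℕ xs h))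

  ≤-foldr-⊔ : (h : A → ℕ) {a : A} (xs : List A) → a ∈ xs → h a ℕ.≤ foldr ℕ._⊔_ 0 (map h xs)
  ≤-foldr-⊔ h (x ∷ xs) (here refl) = ℕ.m≤m⊔n (h x) _
  ≤-foldr-⊔ h (x ∷ xs) (there a∈) = ℕ.≤-trans (≤-foldr-⊔ h xs a∈) (ℕ.m≤n⊔m (h x) _)

  Σ-square-expand : (xs : List A) (α β : ℤ) (h : A → ℤ) →
    Σ xs (λ t → (α * h t - β) * (α * h t - β)) ≡
    α * α * Σ xs (λ t → h t * h t) - + 2 * α * β * Σ xs h + β * β * + length xs
  Σ-square-expand [] α β h = empty α β
    where empty : ∀ α β → 0ℤ ≡ α * α * 0ℤ - + 2 * α * β * 0ℤ + β * β * 0ℤ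
          empty = solve-∀
  Σ-square-expand (x ∷ xs) α β h rewrite Σ-square-expand xs α β h =
    step α β (h x) (Σ xs (λ t → h t * h t)) (Σ xs h) (+ length xs)
    where step : ∀ α β a Q S n → (α * a - β) * (α * a - β) + (α * α * Q - + 2 * α * β * S + β * β * n) ≡
                   α * α * (a * a + Q) - + 2 * α * β * (a + S) + β * β * (1ℤ + n)
          step = solve-∀

  -- Cauchy–Schwarz: (Σ f)² ≤ |xs| Σ f².  With n = |xs|, S = Σ f, Q = Σ f², the expansion
  -- above gives 0 ≤ Σ (n f − S)² = n (n Q − S²), and n > 0 unless xs is empty.
  cauchy-schwarz : (xs : List A) (f : A → ℤ) → Σ xs f * Σ xs f ≤ + length xs * Σ xs (λ x → f x * f x)
  cauchy-schwarz [] f = ≤-refl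
  cauchy-schwarz xs@(_ ∷ _) f = 0≤i-j⇒j≤i (*-cancelˡ-≤-pos 0ℤ _ n (begin
      n * 0ℤ                      ≡⟨ *-zeroʳ n ⟩
      0ℤ                          ≤⟨ Σ-nonneg xs (λ x _ → square-nonneg (n * f x - S)) ⟩
      Σ xs (λ x → (n * f x - S) * (n * f x - S)) ≡⟨ Σ-square-expand xs n S f ⟩
      n * n * Q - + 2 * n * S * S + S * S * n    ≡⟨ factor n S Q ⟩
      n * (n * Q - S * S)         ∎))
    where
    open ≤-Reasoning
    n = + length xs
    S = Σ xs f
    Q = Σ xs (λ x → f x * f x)
    square-nonneg : ∀ a → 0ℤ ≤ a * a
    square-nonneg (+ zero) = +≤+ z≤n
    square-nonneg +[1+ _ ] = +≤+ z≤n
    square-nonneg -[1+ _ ] = +≤+ z≤n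
    factor : ∀ n S Q → n * n * Q - + 2 * n * S * S + S * S * n ≡ n * (n * Q - S * S)
    factor = solve-∀

  𝟙 : {P : Set} → Dec P → ℤ
  𝟙 (yes _) = 1ℤ
  𝟙 (no _) = 0ℤ

  𝟙-yes : {P : Set} (d : Dec P) → P → 𝟙 d ≡ 1ℤ
  𝟙-yes (yes _) p = refl
  𝟙-yes (no ¬p) p = ⊥-elim (¬p p)

  𝟙-no : {P : Set} (d : Dec P) → ¬ P → 𝟙 d ≡ 0ℤ
  𝟙-no (yes p) ¬p = ⊥-elim (¬p p)
  𝟙-no (no _) ¬p = refl

  𝟙-nonneg : {P : Set} (d : Dec P) → 0ℤ ≤ 𝟙 d
  𝟙-nonneg (yes _) = +≤+ z≤n
  𝟙-nonneg (no _) = +≤+ z≤n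

  𝟙≤1 : {P : Set} (d : Dec P) → 𝟙 d ≤ 1ℤ
  𝟙≤1 (yes _) = ≤-refl
  𝟙≤1 (no _) = +≤+ z≤n

  𝟙-mono : {P Q : Set} (d : Dec P) (e : Dec Q) → (P → Q) → 𝟙 d ≤ 𝟙 e
  𝟙-mono (yes p) e P⇒Q = ≤-reflexive (sym (𝟙-yes e (P⇒Q p)))
  𝟙-mono (no _) e P⇒Q = 𝟙-nonneg e

  𝟙-iff : {P Q : Set} (d : Dec P) (e : Dec Q) → (P → Q) → (Q → P) → 𝟙 d ≡ 𝟙 e
  𝟙-iff d e P⇒Q Q⇒P = ≤-antisym (𝟙-mono d e P⇒Q) (𝟙-mono e d Q⇒P)

  length-filter : {P : Pred A _} (P? : Decidable P) (xs : List A) →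
    + length (filter P? xs) ≡ Σ xs (λ x → 𝟙 (P? x))
  length-filter P? [] = refl
  length-filter P? (x ∷ xs) with P? x
  ... | yes _ = cong (λ s → 1ℤ + s) (length-filter P? xs)
  ... | no _ = trans (length-filter P? xs) (sym (+-identityˡ _))

  Σ-𝟙-≤1 : {P : Pred A _} (P? : Decidable P) (xs : List A) → Unique xs →
    (∀ a b → P a → P b → a ≡ b) → Σ xs (λ x → 𝟙 (P? x)) ≤ 1ℤ
  Σ-𝟙-≤1 P? [] _ _ = +≤+ z≤n
  Σ-𝟙-≤1 P? (x ∷ xs) (x∉xs ∷ u) at-most-one with P? x
  ... | no _ = ≤-trans (≤-reflexive (+-identityˡ _)) (Σ-𝟙-≤1 P? xs u at-most-one)
  ... | yes px = ≤-reflexive (cong (λ s → 1ℤ + s) (trans (Σ-cong xs rest-fail) (Σ-zero xs)))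
    where
    rest-fail : ∀ y → y ∈ xs → 𝟙 (P? y) ≡ 0ℤ
    rest-fail y y∈ = 𝟙-no (P? y) (λ py → lookup≢ x∉xs y∈ (at-most-one x y px py))
      where
      lookup≢ : ∀ {zs} → All (x ≢_) zs → ∀ {z} → z ∈ zs → x ≢ z
      lookup≢ (x≢z ∷ _) (here refl) = x≢z
      lookup≢ (_ ∷ ps) (there z∈) = lookup≢ ps z∈

  Σ-𝟙-≡1 : {P : Pred A _} (P? : Decidable P) (xs : List A) → Unique xs → {a : A} → a ∈ xs → P a →
    (∀ b c → P b → P c → b ≡ c) → Σ xs (λ x → 𝟙 (P? x)) ≡ 1ℤ
  Σ-𝟙-≡1 P? xs u a∈ pa at-most-one = ≤-antisym (Σ-𝟙-≤1 P? xs u at-most-one)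
    (≤-trans (≤-reflexive (sym (𝟙-yes (P? _) pa))) (term≤Σ xs a∈ (λ x _ → 𝟙-nonneg (P? x))))

  Σ-𝟙-≤𝟙 : {P : Pred A _} {Q : Set} (P? : Decidable P) (Q? : Dec Q) (xs : List A) → Unique xs →
    (∀ a b → P a → P b → a ≡ b) → (∀ a → a ∈ xs → P a → Q) → Σ xs (λ x → 𝟙 (P? x)) ≤ 𝟙 Q?
  Σ-𝟙-≤𝟙 P? (yes _) xs u at-most-one _ = Σ-𝟙-≤1 P? xs u at-most-one
  Σ-𝟙-≤𝟙 P? (no ¬q) xs u _ P⇒Q = ≤-reflexive
    (trans (Σ-cong xs (λ x x∈ → 𝟙-no (P? x) (λ px → ¬q (P⇒Q x x∈ px)))) (Σ-zero xs))

  Σ-delta : (_≟_ : DecidableEquality A) (xs : List A) → Unique xs → {a : A} → a ∈ xs →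
    (f : A → ℤ) → Σ xs (λ x → 𝟙 (a ≟ x) * f x) ≡ f a
  Σ-delta _≟_ xs u {a} a∈ f = begin
    Σ xs (λ x → 𝟙 (a ≟ x) * f x)  ≡⟨ Σ-cong xs (λ x _ → evaluate x) ⟩
    Σ xs (λ x → 𝟙 (a ≟ x) * f a)  ≡⟨ Σ-*ʳ xs (f a) _ ⟩
    Σ xs (λ x → 𝟙 (a ≟ x)) * f a  ≡⟨ cong (_* f a) (Σ-𝟙-≡1 (a ≟_) xs u a∈ refl (λ b c a≡b a≡c → trans (sym a≡b) a≡c)) ⟩
    1ℤ * f a                      ≡⟨ *-identityˡ (f a) ⟩
    f a                           ∎
    where
    open ≡-Reasoning
    evaluate : ∀ x → 𝟙 (a ≟ x) * f x ≡ 𝟙 (a ≟ x) * f a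
    evaluate x with a ≟ x
    ... | yes refl = refl
    ... | no _ = refl

  Σ-𝟙-complement : {P : Pred A _} (P? : Decidable P) (xs : List A) →
    Σ xs (λ x → 𝟙 (¬? (P? x))) + Σ xs (λ x → 𝟙 (P? x)) ≡ + length xs
  Σ-𝟙-complement P? xs = begin
    Σ xs (λ x → 𝟙 (¬? (P? x))) + Σ xs (λ x → 𝟙 (P? x))  ≡⟨ Σ-+ xs _ _ ⟨
    Σ xs (λ x → 𝟙 (¬? (P? x)) + 𝟙 (P? x))              ≡⟨ Σ-cong xs (λ x _ → complement (P? x)) ⟩
    Σ xs (λ _ → 1ℤ)                                    ≡⟨ trans (Σ-const xs 1ℤ) (*-identityˡ _) ⟩
    + length xs                                        ∎
    where
    open ≡-Reasoning
    complement : {Q : Set} (d : Dec Q) → 𝟙 (¬? d) + 𝟙 d ≡ 1ℤ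
    complement (yes _) = refl
    complement (no _) = refl

  member⇒length-positive : {a : A} {xs : List A} → a ∈ xs → Positive (+ length xs)
  member⇒length-positive (here _) = _
  member⇒length-positive (there _) = _

-- Arithmetic in the field 𝔽 and in the plane 𝔽² with its dot product.
module PlaneAlgebra (𝔽 : FiniteField) where
  open import Level using (0ℓ)
  open import Data.Product.Base using (_,_; proj₁; proj₂)
  open import Data.Empty using (⊥-elim)
  open import Relation.Nullary using (yes; no)
  open import Relation.Binary.PropositionalEquality
  open import Algebra.Bundles using (CommutativeRing)

  open FiniteField 𝔽

  ring : CommutativeRing 0ℓ 0ℓ
  ring = record { isCommutativeRing = isCommutativeRing }

  open CommutativeRing ring
    using (_-_; *-comm; *-assoc; zeroʳ; *-identityˡ; distribˡ)
  open import Algebra.Properties.Ring (CommutativeRing.ring ring) using (x[y-z]≈xy-xz)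
  open import Algebra.Properties.Group (CommutativeRing.+-group ring)
    using (x∙y⁻¹≈ε⇒x≈y; x≈y⇒x∙y⁻¹≈ε; ∙-cancelˡ; ∙-cancelʳ)
  open import Algebra.Properties.AbelianGroup (CommutativeRing.+-abelianGroup ring) using (⁻¹-∙-comm)
  open import Algebra.Properties.CommutativeSemigroup (CommutativeRing.+-commutativeSemigroup ring)
    using (interchange)
  open ≡-Reasoning

  inverse-cancel : ∀ {s i} a → s * i ≡ 1# → i * (s * a) ≡ a
  inverse-cancel {s} {i} a si≡1 = begin
    i * (s * a)  ≡⟨ *-assoc i s a ⟨
    i * s * a    ≡⟨ cong (_* a) (trans (*-comm i s) si≡1) ⟩
    1# * a       ≡⟨ *-identityˡ a ⟩
    a            ∎

  *-cancelˡ : ∀ {s a b} → s ≢ 0# → s * a ≡ s * b → a ≡ b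
  *-cancelˡ {s} {a} {b} s≢0 sa≡sb with inverse s s≢0
  ... | i , si≡1 = trans (sym (inverse-cancel a si≡1)) (trans (cong (i *_) sa≡sb) (inverse-cancel b si≡1))

  *-cancelʳ : ∀ {s a b} → s ≢ 0# → a * s ≡ b * s → a ≡ b
  *-cancelʳ {s} {a} {b} s≢0 as≡bs = *-cancelˡ s≢0 (trans (*-comm s a) (trans as≡bs (*-comm b s)))

  zero-product : ∀ {s a} → s ≢ 0# → s * a ≡ 0# → a ≡ 0#
  zero-product {s} s≢0 sa≡0 = *-cancelˡ s≢0 (trans sa≡0 (sym (zeroʳ s)))

  inverse-nonzero : ∀ {s i} → s * i ≡ 1# → i ≢ 0#
  inverse-nonzero {s} si≡1 refl = 0≢1 (trans (sym (zeroʳ s)) si≡1)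

  unique-rootˡ : ∀ {c d a b} → c ≢ 0# → a * c + d ≡ 0# → b * c + d ≡ 0# → a ≡ b
  unique-rootˡ {d = d} c≢0 a-root b-root = *-cancelʳ c≢0 (∙-cancelʳ d _ _ (trans a-root (sym b-root)))

  unique-rootʳ : ∀ {c d a b} → c ≢ 0# → d + a * c ≡ 0# → d + b * c ≡ 0# → a ≡ b
  unique-rootʳ {d = d} c≢0 a-root b-root = *-cancelʳ c≢0 (∙-cancelˡ d _ _ (trans a-root (sym b-root)))

  _-ₚ_ : Pt 𝔽 → Pt 𝔽 → Pt 𝔽
  (y₁ , y₂) -ₚ (u₁ , u₂) = y₁ - u₁ , y₂ - u₂

  -ₚ-nonzero : ∀ {y u} → y ≢ u → y -ₚ u ≢ 0ₚ 𝔽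
  -ₚ-nonzero {y₁ , y₂} {u₁ , u₂} y≢u y-u≡0 =
    y≢u (cong₂ _,_ (x∙y⁻¹≈ε⇒x≈y y₁ u₁ (cong proj₁ y-u≡0)) (x∙y⁻¹≈ε⇒x≈y y₂ u₂ (cong proj₂ y-u≡0)))

  dot-difference : ∀ z y u → dot 𝔽 z y - dot 𝔽 z u ≡ dot 𝔽 z (y -ₚ u)
  dot-difference (z₁ , z₂) (y₁ , y₂) (u₁ , u₂) = begin
    (z₁ * y₁ + z₂ * y₂) - (z₁ * u₁ + z₂ * u₂)              ≡⟨ cong ((z₁ * y₁ + z₂ * y₂) +_) (⁻¹-∙-comm (z₁ * u₁) (z₂ * u₂)) ⟨
    (z₁ * y₁ + z₂ * y₂) + (- (z₁ * u₁) + - (z₂ * u₂))      ≡⟨ interchange (z₁ * y₁) (z₂ * y₂) (- (z₁ * u₁)) (- (z₂ * u₂)) ⟩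
    (z₁ * y₁ - z₁ * u₁) + (z₂ * y₂ - z₂ * u₂)              ≡⟨ cong₂ _+_ (x[y-z]≈xy-xz z₁ y₁ u₁) (x[y-z]≈xy-xz z₂ y₂ u₂) ⟨
    z₁ * (y₁ - u₁) + z₂ * (y₂ - u₂)                        ∎

  equal-dots⇒orthogonal : ∀ z y u → dot 𝔽 z y ≡ dot 𝔽 z u → dot 𝔽 z (y -ₚ u) ≡ 0#
  equal-dots⇒orthogonal z y u zy≡zu = trans (sym (dot-difference z y u)) (x≈y⇒x∙y⁻¹≈ε zy≡zu)

  dot-scale : ∀ s x y → dot 𝔽 (scale 𝔽 s x) y ≡ s * dot 𝔽 x y
  dot-scale s (x₁ , x₂) (y₁ , y₂) =
    trans (cong₂ _+_ (*-assoc s x₁ y₁) (*-assoc s x₂ y₂)) (sym (distribˡ s (x₁ * y₁) (x₂ * y₂)))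

  scale-injective : ∀ {s s' x} → x ≢ 0ₚ 𝔽 → scale 𝔽 s x ≡ scale 𝔽 s' x → s ≡ s'
  scale-injective {x = x₁ , x₂} x≢0 sx≡s'x with x₁ ≟ 0# | x₂ ≟ 0#
  ... | yes refl | yes refl = ⊥-elim (x≢0 refl)
  ... | no x₁≢0 | _ = *-cancelʳ x₁≢0 (cong proj₁ sx≡s'x)
  ... | yes _ | no x₂≢0 = *-cancelʳ x₂≢0 (cong proj₂ sx≡s'x)

  scale-nonzero : ∀ {s x} → s ≢ 0# → x ≢ 0ₚ 𝔽 → scale 𝔽 s x ≢ 0ₚ 𝔽
  scale-nonzero s≢0 x≢0 sx≡0 =
    x≢0 (cong₂ _,_ (zero-product s≢0 (cong proj₁ sx≡0)) (zero-product s≢0 (cong proj₂ sx≡0)))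

  scale-inverse : ∀ {s i} x → s * i ≡ 1# → scale 𝔽 i (scale 𝔽 s x) ≡ x
  scale-inverse (x₁ , x₂) si≡1 = cong₂ _,_ (inverse-cancel x₁ si≡1) (inverse-cancel x₂ si≡1)

-- Counting in 𝔽 and 𝔽²: the order q, the number k of nonzero scalars, and zeros of linear forms.
module FieldCounting (𝔽 : FiniteField) where
  open IntegerSums
  open PlaneAlgebra 𝔽
  open import Data.Integer.Base using (ℤ; +_; 0ℤ; 1ℤ; _+_; _-_; _*_; _≤_; Positive)
  open import Data.Integer.Properties
    using (≤-trans; ≤-reflexive; *-identityˡ; *-assoc; module ≤-Reasoning)
  open import Data.Integer.Tactic.RingSolver using (solve-∀)
  open import Data.List.Membership.Propositional.Properties using (∈-filter⁺; ∈-filter⁻; ∈-cartesianProduct⁺)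
  import Data.List.Relation.Unary.Unique.Propositional.Properties as Unique
  open import Data.Product.Base using (_,_; proj₂)
  open import Relation.Nullary using (yes; no)
  open import Relation.Nullary.Decidable using (¬?)
  open import Relation.Binary.PropositionalEquality

  open FiniteField 𝔽 using (K; 0#; _≟_; elements; elements-unique; elements-complete; 0≢1)
    renaming (_+_ to _+ᴷ_; _*_ to _*ᴷ_)

  q : ℤ
  q = + order 𝔽

  q-positive : Positive q
  q-positive = member⇒length-positive (elements-complete 0#)

  centred-square-sum : (h : K → ℤ) (c : ℤ) → Σ elements h ≡ c →
    Σ elements (λ t → (q * h t - c) * (q * h t - c)) ≡ q * (q * Σ elements (λ t → h t * h t) - c * c)
  centred-square-sum h c Σh≡c = begin
    Σ elements (λ t → (q * h t - c) * (q * h t - c))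
      ≡⟨ Σ-square-expand elements q c h ⟩
    q * q * Σ elements (λ t → h t * h t) - + 2 * q * c * Σ elements h + c * c * q
      ≡⟨ cong (λ s → q * q * Σ elements (λ t → h t * h t) - + 2 * q * c * s + c * c * q) Σh≡c ⟩
    q * q * Σ elements (λ t → h t * h t) - + 2 * q * c * c + c * c * q
      ≡⟨ factor q (Σ elements (λ t → h t * h t)) c ⟩
    q * (q * Σ elements (λ t → h t * h t) - c * c) ∎
    where
    open ≡-Reasoning
    factor : ∀ q Q c → q * q * Q - + 2 * q * c * c + c * c * q ≡ q * (q * Q - c * c)
    factor = solve-∀

  allPts-unique : Unique (allPts 𝔽)
  allPts-unique = Unique.cartesianProduct⁺ elements-unique elements-unique

  allPts-complete : ∀ z → z ∈ allPts 𝔽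
  allPts-complete (z₁ , z₂) = ∈-cartesianProduct⁺ (elements-complete z₁) (elements-complete z₂)

  at-most-once-each : {h : K → K → ℤ} → (∀ r → Σ elements (h r) ≤ 1ℤ) →
    Σ elements (λ r → Σ elements (h r)) ≤ q
  at-most-once-each rows≤1 = ≤-trans (Σ-mono elements (λ r _ → rows≤1 r))
    (≤-reflexive (trans (Σ-const elements 1ℤ) (*-identityˡ q)))

  Σ-plane-const : (c : ℤ) → Σ (allPts 𝔽) (λ _ → c) ≡ c * (q * q)
  Σ-plane-const c = begin
    Σ (allPts 𝔽) (λ _ → c)             ≡⟨ Σ-cartesianProduct elements elements (λ _ → c) ⟩
    Σ elements (λ _ → Σ elements (λ _ → c)) ≡⟨ Σ-cong elements (λ _ _ → Σ-const elements c) ⟩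
    Σ elements (λ _ → c * q)           ≡⟨ Σ-const elements (c * q) ⟩
    c * q * q                          ≡⟨ *-assoc c q q ⟩
    c * (q * q)                        ∎
    where open ≡-Reasoning

  k : ℤ
  k = + length (nonzeroScalars 𝔽)

  nonzeroScalar≢0 : ∀ {s} → s ∈ nonzeroScalars 𝔽 → s ≢ 0#
  nonzeroScalar≢0 s∈ = proj₂ (∈-filter⁻ (λ s → ¬? (s ≟ 0#)) {xs = elements} s∈)

  nonzeroScalar∈ : ∀ {s} → s ≢ 0# → s ∈ nonzeroScalars 𝔽
  nonzeroScalar∈ {s} s≢0 = ∈-filter⁺ (λ s → ¬? (s ≟ 0#)) (elements-complete s) s≢0

  nonzeroScalars-unique : Unique (nonzeroScalars 𝔽)
  nonzeroScalars-unique = Unique.filter⁺ (λ s → ¬? (s ≟ 0#)) elements-unique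

  k-positive : Positive k
  k-positive = member⇒length-positive (nonzeroScalar∈ (λ 1≡0 → 0≢1 (sym 1≡0)))

  k+1≡q : k + 1ℤ ≡ q
  k+1≡q = begin
    k + 1ℤ                                                       ≡⟨ cong₂ _+_ (length-filter (λ s → ¬? (s ≟ 0#)) elements) (sym zero-once) ⟩
    Σ elements (λ s → 𝟙 (¬? (s ≟ 0#))) + Σ elements (λ s → 𝟙 (s ≟ 0#)) ≡⟨ Σ-𝟙-complement (_≟ 0#) elements ⟩
    q                                                            ∎
    where
    open ≡-Reasoning
    zero-once : Σ elements (λ s → 𝟙 (s ≟ 0#)) ≡ 1ℤ
    zero-once = Σ-𝟙-≡1 (_≟ 0#) elements elements-unique (elements-complete 0#) refl
                  (λ b c b≡0 c≡0 → trans b≡0 (sym c≡0))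

  -- A nonzero linear form z ↦ z·w on 𝔽² has at most q zeros: if w₁ ≠ 0 then each z₂ determines z₁,
  -- and otherwise w₂ ≠ 0 and each z₁ determines z₂.
  orthogonal-count : ∀ w → w ≢ 0ₚ 𝔽 → Σ (allPts 𝔽) (λ z → 𝟙 (dot 𝔽 z w ≟ 0#)) ≤ q
  orthogonal-count (w₁ , w₂) w≢0 with w₁ ≟ 0#
  ... | no w₁≢0 = begin
    Σ (allPts 𝔽) (λ z → 𝟙 (dot 𝔽 z (w₁ , w₂) ≟ 0#))                      ≡⟨ Σ-cartesianProduct elements elements _ ⟩
    Σ elements (λ z₁ → Σ elements (λ z₂ → 𝟙 ((z₁ *ᴷ w₁ +ᴷ z₂ *ᴷ w₂) ≟ 0#))) ≡⟨ Σ-swap elements elements _ ⟩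
    Σ elements (λ z₂ → Σ elements (λ z₁ → 𝟙 ((z₁ *ᴷ w₁ +ᴷ z₂ *ᴷ w₂) ≟ 0#))) ≤⟨ at-most-once-each (λ z₂ →
        Σ-𝟙-≤1 _ elements elements-unique (λ a b → unique-rootˡ w₁≢0)) ⟩
    q                                                                    ∎
    where open ≤-Reasoning
  ... | yes refl = begin
    Σ (allPts 𝔽) (λ z → 𝟙 (dot 𝔽 z (0# , w₂) ≟ 0#))                      ≡⟨ Σ-cartesianProduct elements elements _ ⟩
    Σ elements (λ z₁ → Σ elements (λ z₂ → 𝟙 ((z₁ *ᴷ 0# +ᴷ z₂ *ᴷ w₂) ≟ 0#))) ≤⟨ at-most-once-each (λ z₁ →
        Σ-𝟙-≤1 _ elements elements-unique (λ a b → unique-rootʳ w₂≢0)) ⟩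
    q                                                                    ∎
    where
    open ≤-Reasoning
    w₂≢0 : w₂ ≢ 0#
    w₂≢0 w₂≡0 = w≢0 (cong (0# ,_) w₂≡0)

  -- Hence two distinct points y ≠ u have equal dot products with at most q points z
  -- (those orthogonal to u − y).
  equal-dots-count : ∀ y u → y ≢ u → Σ (allPts 𝔽) (λ z → 𝟙 (dot 𝔽 z u ≟ dot 𝔽 z y)) ≤ q
  equal-dots-count y u y≢u = ≤-trans
    (Σ-mono (allPts 𝔽) (λ z _ → 𝟙-mono (dot 𝔽 z u ≟ dot 𝔽 z y) (dot 𝔽 z (u -ₚ y) ≟ 0#)
      (equal-dots⇒orthogonal z u y)))
    (orthogonal-count (u -ₚ y) (-ₚ-nonzero (λ u≡y → y≢u (sym u≡y))))

-- The excess of a direction x ∈ 𝔽² with respect to a set G measures how far the distribution of the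
-- values x·y (y ∈ G) is from uniform.
module Excess (𝔽 : FiniteField) (G : List (Pt 𝔽)) (G-unique : Unique G) where
  open IntegerSums
  open PlaneAlgebra 𝔽
  open FieldCounting 𝔽
  open import Data.Integer.Base using (ℤ; +_; 0ℤ; 1ℤ; _+_; _-_; -_; _*_; _≤_; NonNegative)
  open import Data.Integer.Properties
    using (≤-trans; ≤-reflexive; i≤j⇒0≤j-i; *-identityˡ; *-identityʳ; *-zeroʳ; +-identityʳ; *-comm; +-monoˡ-≤; +-monoʳ-≤;
           *-monoˡ-≤-nonNeg; pos-*; module ≤-Reasoning)
  open import Data.Integer.Tactic.RingSolver using (solve-∀)
  open import Relation.Nullary using (yes; no)
  open import Relation.Binary.PropositionalEquality
  open FiniteField 𝔽 using (K; 0#; _≟_; elements; elements-unique; elements-complete) renaming (_*_ to _*ᴷ_)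

  nG : ℤ
  nG = + length G

  incidences : Pt 𝔽 → K → ℤ
  incidences x t = Σ G (λ y → 𝟙 (dot 𝔽 x y ≟ t))

  collisions : Pt 𝔽 → ℤ
  collisions x = Σ G (λ y → Σ G (λ y' → 𝟙 (dot 𝔽 x y' ≟ dot 𝔽 x y)))

  excess : Pt 𝔽 → ℤ
  excess x = q * collisions x - nG * nG

  incidences-total : ∀ x → Σ elements (incidences x) ≡ nG
  incidences-total x = begin
    Σ elements (λ t → Σ G (λ y → 𝟙 (dot 𝔽 x y ≟ t)))  ≡⟨ Σ-swap elements G _ ⟩
    Σ G (λ y → Σ elements (λ t → 𝟙 (dot 𝔽 x y ≟ t)))  ≡⟨ Σ-cong G (λ y _ → Σ-𝟙-≡1 (dot 𝔽 x y ≟_) elements elements-unique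
                                                           (elements-complete _) refl (λ b c xy≡b xy≡c → trans (sym xy≡b) xy≡c)) ⟩
    Σ G (λ _ → 1ℤ)                                    ≡⟨ trans (Σ-const G 1ℤ) (*-identityˡ nG) ⟩
    nG                                                ∎
    where open ≡-Reasoning

  incidences-square : ∀ x → Σ elements (λ t → incidences x t * incidences x t) ≡ collisions x
  incidences-square x = begin
    Σ elements (λ t → incidences x t * incidences x t)
      ≡⟨ Σ-cong elements (λ t _ → trans (sym (Σ-*ʳ G (incidences x t) _))
                                       (Σ-cong G (λ y _ → sym (Σ-*ˡ G (𝟙 (dot 𝔽 x y ≟ t)) (λ y' → 𝟙 (dot 𝔽 x y' ≟ t)))))) ⟩
    Σ elements (λ t → Σ G (λ y → Σ G (λ y' → 𝟙 (dot 𝔽 x y ≟ t) * 𝟙 (dot 𝔽 x y' ≟ t))))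
      ≡⟨ Σ-swap elements G _ ⟩
    Σ G (λ y → Σ elements (λ t → Σ G (λ y' → 𝟙 (dot 𝔽 x y ≟ t) * 𝟙 (dot 𝔽 x y' ≟ t))))
      ≡⟨ Σ-cong G (λ y _ → Σ-swap elements G _) ⟩
    Σ G (λ y → Σ G (λ y' → Σ elements (λ t → 𝟙 (dot 𝔽 x y ≟ t) * 𝟙 (dot 𝔽 x y' ≟ t))))
      ≡⟨ Σ-cong G (λ y _ → Σ-cong G (λ y' _ →
           Σ-delta _≟_ elements elements-unique (elements-complete _) (λ t → 𝟙 (dot 𝔽 x y' ≟ t)))) ⟩
    collisions x ∎
    where open ≡-Reasoning

  -- The excess is nonnegative by Cauchy–Schwarz: |G|² = (Σ_t incidences)² ≤ q Σ_t incidences².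
  excess-nonneg : ∀ x → 0ℤ ≤ excess x
  excess-nonneg x = i≤j⇒0≤j-i
    (subst₂ (λ n c → n * n ≤ q * c) (incidences-total x) (incidences-square x)
      (cauchy-schwarz elements (incidences x)))

  excess-deviation : ∀ x → Σ elements (λ t → (q * incidences x t - nG) * (q * incidences x t - nG)) ≡ q * excess x
  excess-deviation x = trans (centred-square-sum (incidences x) nG (incidences-total x))
    (cong (λ c → q * (q * c - nG * nG)) (incidences-square x))

  -- Scaling x by a nonzero s permutes the values x·y, so the excess only depends on the line through x.
  excess-scale : ∀ {s} x → s ≢ 0# → excess (scale 𝔽 s x) ≡ excess x
  excess-scale {s} x s≢0 = cong (λ c → q * c - nG * nG)
    (Σ-cong G (λ y _ → Σ-cong G (λ y' _ → 𝟙-iff _ _ (cancel y' y) (uncancel y' y))))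
    where
    cancel : ∀ y' y → dot 𝔽 (scale 𝔽 s x) y' ≡ dot 𝔽 (scale 𝔽 s x) y → dot 𝔽 x y' ≡ dot 𝔽 x y
    cancel y' y eq = *-cancelˡ s≢0 (trans (sym (dot-scale s x y')) (trans eq (dot-scale s x y)))
    uncancel : ∀ y' y → dot 𝔽 x y' ≡ dot 𝔽 x y → dot 𝔽 (scale 𝔽 s x) y' ≡ dot 𝔽 (scale 𝔽 s x) y
    uncancel y' y eq = trans (dot-scale s x y') (trans (cong (s *ᴷ_) eq) (sym (dot-scale s x y)))

  -- Two points y, y' of G have equal dot products with all q² points z if y = y', and with at most q
  -- points otherwise; note q² = q + qk.
  pair-collisions : ∀ y y' → Σ (allPts 𝔽) (λ z → 𝟙 (dot 𝔽 z y' ≟ dot 𝔽 z y)) ≤ q + q * k * 𝟙 (_≟ₚ_ 𝔽 y' y)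
  pair-collisions y y' with _≟ₚ_ 𝔽 y' y
  ... | yes _ = begin
    Σ (allPts 𝔽) (λ z → 𝟙 (dot 𝔽 z y' ≟ dot 𝔽 z y)) ≤⟨ Σ-mono (allPts 𝔽) (λ z _ → 𝟙≤1 _) ⟩
    Σ (allPts 𝔽) (λ _ → 1ℤ)                            ≡⟨ Σ-plane-const 1ℤ ⟩
    1ℤ * (q * q)                                       ≡⟨ cong (λ p → 1ℤ * (q * p)) (sym k+1≡q) ⟩
    1ℤ * (q * (k + 1ℤ))                                ≡⟨ expand q k ⟩
    q + q * k * 1ℤ                                     ∎
    where
    open ≤-Reasoning
    expand : ∀ q k → 1ℤ * (q * (k + 1ℤ)) ≡ q + q * k * 1ℤ
    expand = solve-∀
  ... | no y'≢y = ≤-trans (equal-dots-count y y' (λ y≡y' → y'≢y (sym y≡y')))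
                    (≤-reflexive (sym (trans (cong (λ s → q + s) (*-zeroʳ (q * k))) (+-identityʳ q))))

  collisions-total : Σ (allPts 𝔽) collisions ≤ nG * (q * nG + q * k)
  collisions-total = begin
    Σ (allPts 𝔽) collisions
      ≡⟨ trans (Σ-swap (allPts 𝔽) G _) (Σ-cong G (λ y _ → Σ-swap (allPts 𝔽) G _)) ⟩
    Σ G (λ y → Σ G (λ y' → Σ (allPts 𝔽) (λ z → 𝟙 (dot 𝔽 z y' ≟ dot 𝔽 z y))))
      ≤⟨ Σ-mono G (λ y _ → Σ-mono G (λ y' _ → pair-collisions y y')) ⟩
    Σ G (λ y → Σ G (λ y' → q + q * k * 𝟙 (_≟ₚ_ 𝔽 y' y)))
      ≤⟨ Σ-mono G (λ y _ → row-bound y) ⟩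
    Σ G (λ _ → q * nG + q * k)
      ≡⟨ trans (Σ-const G _) (*-comm _ nG) ⟩
    nG * (q * nG + q * k) ∎
    where
    open ≤-Reasoning
    qk-nonneg : NonNegative (q * k)
    qk-nonneg = subst NonNegative (pos-* (order 𝔽) (length (nonzeroScalars 𝔽))) _
    row-bound : ∀ y → Σ G (λ y' → q + q * k * 𝟙 (_≟ₚ_ 𝔽 y' y)) ≤ q * nG + q * k
    row-bound y = begin
      Σ G (λ y' → q + q * k * 𝟙 (_≟ₚ_ 𝔽 y' y))        ≡⟨ Σ-+ G _ _ ⟩
      Σ G (λ _ → q) + Σ G (λ y' → q * k * 𝟙 (_≟ₚ_ 𝔽 y' y)) ≡⟨ cong₂ _+_ (Σ-const G q) (Σ-*ˡ G (q * k) _) ⟩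
      q * nG + q * k * Σ G (λ y' → 𝟙 (_≟ₚ_ 𝔽 y' y))     ≤⟨ +-monoʳ-≤ (q * nG) (*-monoˡ-≤-nonNeg (q * k) ⦃ qk-nonneg ⦄
                                                       (Σ-𝟙-≤1 (λ a → _≟ₚ_ 𝔽 a y) G G-unique (λ a b a≡y b≡y → trans a≡y (sym b≡y)))) ⟩
      q * nG + q * k * 1ℤ                           ≡⟨ cong (λ s → q * nG + s) (*-identityʳ (q * k)) ⟩
      q * nG + q * k                                ∎

  excess-total : Σ (allPts 𝔽) excess ≤ q * q * k * nG
  excess-total = begin
    Σ (allPts 𝔽) excess                          ≡⟨ Σ-+ (allPts 𝔽) (λ z → q * collisions z) (λ _ → - (nG * nG)) ⟩
    Σ (allPts 𝔽) (λ z → q * collisions z) + Σ (allPts 𝔽) (λ _ → - (nG * nG))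
                                                 ≡⟨ cong₂ _+_ (Σ-*ˡ (allPts 𝔽) q collisions) (Σ-plane-const (- (nG * nG))) ⟩
    q * Σ (allPts 𝔽) collisions + - (nG * nG) * (q * q)
                                                 ≤⟨ +-monoˡ-≤ _ (*-monoˡ-≤-nonNeg q ⦃ q-nonneg ⦄ collisions-total) ⟩
    q * (nG * (q * nG + q * k)) + - (nG * nG) * (q * q)
                                                 ≡⟨ simplify q k nG ⟩
    q * q * k * nG                               ∎
    where
    open ≤-Reasoning
    q-nonneg : NonNegative q
    q-nonneg = _
    simplify : ∀ q k n → q * (n * (q * n + q * k)) + - (n * n) * (q * q) ≡ q * q * k * n
    simplify = solve-∀

module DotProductEnergy (𝔽 : FiniteField) (F G : List (Pt 𝔽)) (G-unique : Unique G) (0∉F : ¬ (0ₚ 𝔽 ∈ F)) where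
  open IntegerSums
  open PlaneAlgebra 𝔽
  open FieldCounting 𝔽
  open Excess 𝔽 G G-unique
  open import Data.Nat.Base as ℕ using (z≤n)
  open import Data.Integer.Base using (ℤ; +_; 0ℤ; _+_; _-_; -_; _*_; _≤_; nonNegative; +≤+)
  open import Data.Integer.Properties
    using (≤-trans; ≤-reflexive; *-comm; +-monoʳ-≤; *-monoˡ-≤-nonNeg; *-monoʳ-≤-nonNeg; *-cancelˡ-≤-pos; pos-*;
           module ≤-Reasoning)
  open import Data.Integer.Tactic.RingSolver using (solve-∀)
  open import Data.List.Base using (cartesianProduct)
  import Data.List.Relation.Unary.Any as Any
  open import Data.List.Membership.Propositional.Properties using (∈-filter⁺)
  open import Data.Product.Base using (_,_; proj₁; proj₂)
  open import Relation.Nullary using (yes; no)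
  open import Relation.Nullary.Decidable using (¬?)
  open import Relation.Binary.PropositionalEquality
  open FiniteField 𝔽 using (K; 0#; _≟_; elements; inverse)

  nF : ℤ
  nF = + length F

  νℤ : K → ℤ
  νℤ t = Σ F (λ x → incidences x t)

  ν≡νℤ : ∀ t → + ν 𝔽 F G t ≡ νℤ t
  ν≡νℤ t = trans (length-filter (λ p → dot 𝔽 (proj₁ p) (proj₂ p) ≟ t) (cartesianProduct F G))
                 (Σ-cartesianProduct F G (λ p → 𝟙 (dot 𝔽 (proj₁ p) (proj₂ p) ≟ t)))

  ν-total : Σ elements νℤ ≡ nF * nG
  ν-total = trans (Σ-swap elements F _)
    (trans (Σ-cong F (λ x _ → incidences-total x)) (trans (Σ-const F nG) (*-comm nG nF)))

  energy : ℤ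
  energy = Σ elements (λ t → νℤ t * νℤ t)

  sumν²≡energy : + sumν² 𝔽 F G ≡ energy
  sumν²≡energy = trans (Σ-fromℕ elements (λ t → ν 𝔽 F G t ℕ.* ν 𝔽 F G t))
    (Σ-cong elements (λ t _ → trans (pos-* (ν 𝔽 F G t) (ν 𝔽 F G t)) (cong₂ _*_ (ν≡νℤ t) (ν≡νℤ t))))

  -- Indeed q(q Σν² − |F|²|G|²) = Σ_t (q ν(t) − |F||G|)² = Σ_t (Σ_{x∈F} (q incidences(x,t) − |G|))²,
  -- which by Cauchy–Schwarz is at most |F| Σ_x Σ_t (q incidences(x,t) − |G|)² = q |F| Σ_x excess(x).
  energy-bound : q * energy - (nF * nG) * (nF * nG) ≤ nF * Σ F excess
  energy-bound = *-cancelˡ-≤-pos _ _ q ⦃ q-positive ⦄ (begin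
    q * (q * energy - (nF * nG) * (nF * nG))
      ≡⟨ centred-square-sum νℤ (nF * nG) ν-total ⟨
    Σ elements (λ t → (q * νℤ t - nF * nG) * (q * νℤ t - nF * nG))
      ≤⟨ Σ-mono elements (λ t _ → subst (λ c → c * c ≤ nF * Σ F (λ x → deviation x t * deviation x t))
                                        (Σ-deviation t) (cauchy-schwarz F (λ x → deviation x t))) ⟩
    Σ elements (λ t → nF * Σ F (λ x → deviation x t * deviation x t))
      ≡⟨ Σ-*ˡ elements nF _ ⟩
    nF * Σ elements (λ t → Σ F (λ x → deviation x t * deviation x t))
      ≡⟨ cong (nF *_) (trans (Σ-swap elements F _) (Σ-cong F (λ x _ → excess-deviation x))) ⟩
    nF * Σ F (λ x → q * excess x)
      ≡⟨ cong (nF *_) (Σ-*ˡ F q excess) ⟩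
    nF * (q * Σ F excess)
      ≡⟨ swap-factors nF q (Σ F excess) ⟩
    q * (nF * Σ F excess) ∎)
    where
    open ≤-Reasoning
    deviation : Pt 𝔽 → K → ℤ
    deviation x t = q * incidences x t - nG
    Σ-deviation : ∀ t → Σ F (λ x → deviation x t) ≡ q * νℤ t - nF * nG
    Σ-deviation t = trans (Σ-+ F (λ x → q * incidences x t) (λ _ → - nG))
      (trans (cong₂ _+_ (Σ-*ˡ F q (λ x → incidences x t)) (Σ-const F (- nG))) (rearrange q (νℤ t) nG nF))
      where rearrange : ∀ q v g f → q * v + - g * f ≡ q * v - f * g
            rearrange = solve-∀
    swap-factors : ∀ a b c → a * (b * c) ≡ b * (a * c)
    swap-factors = solve-∀

  M : ℤ
  M = + maxLineCount 𝔽 F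

  multiplicity : Pt 𝔽 → ℤ
  multiplicity z = Σ F (λ x → Σ (nonzeroScalars 𝔽) (λ s → 𝟙 (_≟ₚ_ 𝔽 (scale 𝔽 s x) z)))

  member≢0 : ∀ {x} → x ∈ F → x ≢ 0ₚ 𝔽
  member≢0 x∈F x≡0 = 0∉F (subst (_∈ F) x≡0 x∈F)

  -- A representation z = s x determines s (as x ≠ 0) and puts x = s⁻¹ z on l_z.
  multiplicity≤lineCount : ∀ z → multiplicity z ≤ + lineCount 𝔽 F z
  multiplicity≤lineCount z = ≤-trans (Σ-mono F at-most-on-line) (≤-reflexive (sym (length-filter (onLine? 𝔽 z) F)))
    where
    on-line : ∀ x {s} → s ≢ 0# → scale 𝔽 s x ≡ z → Any.Any (λ r → x ≡ scale 𝔽 r z) (nonzeroScalars 𝔽)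
    on-line x {s} s≢0 sx≡z with inverse s s≢0
    ... | i , si≡1 = Any.map (λ i≡r → subst (λ r → x ≡ scale 𝔽 r z) i≡r x≡iz) (nonzeroScalar∈ (inverse-nonzero si≡1))
      where
      x≡iz : x ≡ scale 𝔽 i z
      x≡iz = trans (sym (scale-inverse x si≡1)) (cong (scale 𝔽 i) sx≡z)
    at-most-on-line : ∀ x → x ∈ F → Σ (nonzeroScalars 𝔽) (λ s → 𝟙 (_≟ₚ_ 𝔽 (scale 𝔽 s x) z)) ≤ 𝟙 (onLine? 𝔽 z x)
    at-most-on-line x x∈F = Σ-𝟙-≤𝟙 _ (onLine? 𝔽 z x) (nonzeroScalars 𝔽) nonzeroScalars-unique
      (λ s s' sx≡z s'x≡z → scale-injective (member≢0 x∈F) (trans sx≡z (sym s'x≡z)))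
      (λ s s∈ sx≡z → on-line x (nonzeroScalar≢0 s∈) sx≡z)

  -- Hence multiplicity z ≤ |F ∩ l_z| ≤ M for z ≠ 0, while 0 has no representation.
  multiplicity≤M : ∀ z → multiplicity z ≤ M
  multiplicity≤M z with _≟ₚ_ 𝔽 z (0ₚ 𝔽)
  ... | no z≢0 = ≤-trans (multiplicity≤lineCount z)
      (+≤+ (≤-foldr-⊔ (lineCount 𝔽 F) (nonzeroPts 𝔽) (∈-filter⁺ (λ p → ¬? (_≟ₚ_ 𝔽 p (0ₚ 𝔽))) (allPts-complete z) z≢0)))
  ... | yes refl = ≤-trans (≤-reflexive no-representation) (+≤+ z≤n)
    where
    no-representation : multiplicity (0ₚ 𝔽) ≡ 0ℤ
    no-representation = trans
      (Σ-cong F (λ x x∈F → trans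
        (Σ-cong (nonzeroScalars 𝔽) (λ s s∈ → 𝟙-no _ (scale-nonzero (nonzeroScalar≢0 s∈) (member≢0 x∈F))))
        (Σ-zero (nonzeroScalars 𝔽))))
      (Σ-zero F)

  -- Step II: each x ∈ F contributes its excess once for each of the k points s x of its line, and every
  -- point is covered at most M times, so k Σ_{x ∈ F} excess(x) ≤ M Σ_{z ∈ 𝔽²} excess(z).
  excess-lines : Σ F excess * k ≤ M * Σ (allPts 𝔽) excess
  excess-lines = begin
    Σ F excess * k
      ≡⟨ Σ-*ʳ F k excess ⟨
    Σ F (λ x → excess x * k)
      ≡⟨ Σ-cong F (λ x _ → sym (trans (Σ-cong S (λ s s∈ → excess-scale x (nonzeroScalar≢0 s∈))) (Σ-const S (excess x)))) ⟩
    Σ F (λ x → Σ S (λ s → excess (scale 𝔽 s x)))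
      ≡⟨ Σ-cong F (λ x _ → Σ-cong S (λ s _ → sym (Σ-delta (_≟ₚ_ 𝔽) (allPts 𝔽) allPts-unique (allPts-complete _) excess))) ⟩
    Σ F (λ x → Σ S (λ s → Σ A (λ z → 𝟙 (_≟ₚ_ 𝔽 (scale 𝔽 s x) z) * excess z)))
      ≡⟨ trans (Σ-cong F (λ x _ → Σ-swap S A _)) (Σ-swap F A _) ⟩
    Σ A (λ z → Σ F (λ x → Σ S (λ s → 𝟙 (_≟ₚ_ 𝔽 (scale 𝔽 s x) z) * excess z)))
      ≡⟨ Σ-cong A (λ z _ → trans (Σ-cong F (λ x _ → Σ-*ʳ S (excess z) _)) (Σ-*ʳ F (excess z) _)) ⟩
    Σ A (λ z → multiplicity z * excess z)
      ≤⟨ Σ-mono A (λ z _ → *-monoʳ-≤-nonNeg (excess z) ⦃ nonNegative (excess-nonneg z) ⦄ (multiplicity≤M z)) ⟩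
    Σ A (λ z → M * excess z)
      ≡⟨ Σ-*ˡ A M excess ⟩
    M * Σ A excess ∎
    where
    open ≤-Reasoning
    S = nonzeroScalars 𝔽
    A = allPts 𝔽

  excess-F-bound : Σ F excess ≤ q * q * nG * M
  excess-F-bound = *-cancelˡ-≤-pos _ _ k ⦃ k-positive ⦄ (begin
    k * Σ F excess           ≡⟨ *-comm k _ ⟩
    Σ F excess * k           ≤⟨ excess-lines ⟩
    M * Σ (allPts 𝔽) excess  ≤⟨ *-monoˡ-≤-nonNeg M excess-total ⟩
    M * (q * q * k * nG)     ≡⟨ rearrange M q k nG ⟩
    k * (q * q * nG * M)     ∎)
    where
    open ≤-Reasoning
    rearrange : ∀ m q k n → m * (q * q * k * n) ≡ k * (q * q * n * m)
    rearrange = solve-∀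

  energy-estimate : q * energy ≤ nF * nF * (nG * nG) + q * q * (nF * nG) * M
  energy-estimate = begin
    q * energy                                           ≡⟨ split (q * energy) ((nF * nG) * (nF * nG)) ⟩
    (nF * nG) * (nF * nG) + (q * energy - (nF * nG) * (nF * nG)) ≤⟨ +-monoʳ-≤ ((nF * nG) * (nF * nG)) energy-bound ⟩
    (nF * nG) * (nF * nG) + nF * Σ F excess               ≤⟨ +-monoʳ-≤ ((nF * nG) * (nF * nG)) (*-monoˡ-≤-nonNeg nF excess-F-bound) ⟩
    (nF * nG) * (nF * nG) + nF * (q * q * nG * M)         ≡⟨ rearrange nF nG q M ⟩
    nF * nF * (nG * nG) + q * q * (nF * nG) * M           ∎
    where
    open ≤-Reasoning
    split : ∀ a b → a ≡ b + (a - b)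
    split = solve-∀
    rearrange : ∀ f g q m → f * g * (f * g) + f * (q * q * g * m) ≡ f * f * (g * g) + q * q * (f * g) * m
    rearrange = solve-∀

open import Data.Nat.Base using (_≤_; _+_; _*_)
import Data.Integer.Base as ℤ
open import Data.Integer.Properties using (pos-+; pos-*; drop‿+≤+)
open import Relation.Binary.PropositionalEquality using (_≡_; sym; trans; cong; cong₂; subst₂)

-- Theorem 3.1 (with the constant q² in the second term).  The integer estimate transfers to ℕ
-- since +_ : ℕ → ℤ is an order embedding and a semiring homomorphism.
theorem3p1 : (𝔽 : FiniteField) (F G : List (Pt 𝔽)) → Unique F → Unique G → ¬ (0ₚ 𝔽 ∈ F) →
    order 𝔽 * sumν² 𝔽 F G ≤ length F * length F * (length G * length G) + order 𝔽 * order 𝔽 * (length F * length G) * maxLineCount 𝔽 F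
theorem3p1 𝔽 F G _ G-unique 0∉F = drop‿+≤+ (subst₂ ℤ._≤_ (sym lhs) (sym rhs) energy-estimate)
  where
  open DotProductEnergy 𝔽 F G G-unique 0∉F
  open FieldCounting 𝔽 using (q)
  open Excess 𝔽 G G-unique using (nG)
  o = order 𝔽
  f = length F
  g = length G
  m = maxLineCount 𝔽 F
  lhs : ℤ.+ (o * sumν² 𝔽 F G) ≡ q ℤ.* energy
  lhs = trans (pos-* o (sumν² 𝔽 F G)) (cong (q ℤ.*_) sumν²≡energy)
  rhs : ℤ.+ (f * f * (g * g) + o * o * (f * g) * m) ≡ nF ℤ.* nF ℤ.* (nG ℤ.* nG) ℤ.+ q ℤ.* q ℤ.* (nF ℤ.* nG) ℤ.* M
  rhs = trans (pos-+ (f * f * (g * g)) _) (cong₂ ℤ._+_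
    (trans (pos-* (f * f) (g * g)) (cong₂ ℤ._*_ (pos-* f f) (pos-* g g)))
    (trans (pos-* (o * o * (f * g)) m)
      (cong (ℤ._* M) (trans (pos-* (o * o) (f * g)) (cong₂ ℤ._*_ (pos-* o o) (pos-* f g))))))
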